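{- Let $\rho_\gamma$ be an RCES with event set $\{a,b,c\}$ whose reachable configurations are all eight subsets of $\{a,b,c\}$ and whose transitions between reachable configurations are exactly $\emptyset\mapsto\{a\}$, $\emptyset\mapsto\{b\}$, $\emptyset\mapsto\{c\}$, $\{a\}\mapsto\{a,b\}$, $\{a\}\mapsto\{a,c\}$, $\{b\}\mapsto\{a,b\}$, $\{b\}\mapsto\{b,c\}$, $\{c\}\mapsto\{a,c\}$, $\{c\}\mapsto\{b,c\}$, $\{a,c\}\mapsto\{a,b,c\}$, $\{b,c\}\mapsto\{a,b,c\}$. Then no DCES is transition equivalent to $\rho_\gamma$.
   Context: An RCES is $\rho=(E,\vdash)$ with $\vdash\subseteq\mathcal P(E)^2$; $X\mapsto_\rho Y$ iff $X\subsetneq Y$ and for every $Z\subseteq Y$ there is $W\subseteq X$ with $W\vdash Z$; the reachable configurations are the finite $X$ with $\emptyset\mapsto_\rho^*X$. A Dynamic Causality Event Structure (DCES) is $\Delta=(E,\to,\mathrm{Drop},\mathrm{Add})$ with $E$ a set of events, $\to\subseteq E^2$, $\mathrm{Drop},\mathrm{Add}\subseteq E^3$ such that for all $a,c,d,t$: (1) $(d,c,t)\in\mathrm{Drop}$ and no $a$ with $(a,c,t)\in\mathrm{Add}$ implies $c\to t$; (2) $(d,c,t)\in\mathrm{Drop}$ implies $d\notin\{c,t\}$; (3) $(a,c,t)\in\mathrm{Add}$ and no $d$ with $(d,c,t)\in\mathrm{Drop}$ implies $\neg(c\to t)$; (4) $(a,c,t)\in\mathrm{Add}$ implies $a\notin\{c,t\}$;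 (5) $(a,c,t)\in\mathrm{Add}$ implies $(a,c,t)\notin\mathrm{Drop}$. For $X\subseteq Y\subseteq E$ let $\mathrm{dropped}(X,Y)=\{(c,t)\mid\exists d\in Y\setminus X.(d,c,t)\in\mathrm{Drop}\}$ and $\mathrm{added}(X,Y)=\{(c,t)\mid\exists a\in Y\setminus X.(a,c,t)\in\mathrm{Add}\}$. States are pairs $(X,R)$ with $X\subseteq E$, $R\subseteq E^2$; $(X,R_X)\mapsto(Y,R_Y)$ iff (i) $X\subsetneq Y$; (ii) for all $e\in Y\setminus X$, $\{e'\mid(e',e)\in R_X\}\subseteq X$; (iii) $R_Y=(R_X\setminus\mathrm{dropped}(X,Y))\cup\mathrm{added}(X,Y)$; (iv) for all $(c,t)\in\mathrm{added}(X,Y)\cap\mathrm{dropped}(X,Y)$, $c\in X$ or $t\in X$; (v) for all $t,a\in Y\setminus X$ and $c\in E$, $(a,c,t)\in\mathrm{Add}$ implies $c\in X$. A state is reachable if it is reachable from $(\emptyset,\to)$ by $\mapsto^*$ with finite event set. The configurations of $\Delta$ are the event sets of reachable states. A DCES $\Delta$ and an RCES $\rho$ are transition equivalent if their configuration sets coincide and, for configurations $X,Y$, $X\mapsto_\rho Y$ iff there are reachable states $(X,R_X),(Y,R_Y)$ of $\Delta$ with $(X,R_X)\mapsto(Y,R_Y)$. -}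

module Defs where

open import Data.Fin using (Fin; zero; suc)
open import Data.Fin.Subset using (Subset; _∈_; _∉_; _⊆_; _⊂_; ⊥)
open import Data.Bool using (Bool; true; false)
open import Data.Vec using (_∷_; [])
open import Data.Product using (_×_; _,_; Σ; ∃)
open import Data.Sum using (_⊎_)
open import Relation.Nullary using (¬_)
open import Relation.Binary.PropositionalEquality using (_≡_)
open import Relation.Binary.Construct.Closure.ReflexiveTransitive using (Star)
open import Function.Bundles using (_⇔_)

-- Event set E = {a,b,c}, encoded as Fin 3 (a = 0, b = 1, c = 2).
Ev : Set
Ev = Fin 3

Cfg : Set
Cfg = Subset 3

record RCES : Set₁ where
  field
    _⊢_ : Cfg → Cfg → Set

module _ (ρ : RCES) where
  open RCES ρ

  RStep : Cfg → Cfg → Set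
  RStep X Y = X ⊂ Y × (∀ Z → Z ⊆ Y → ∃ λ W → W ⊆ X × (W ⊢ Z))

  RReach : Cfg → Set
  RReach X = Star RStep ⊥ X

record DCES : Set where
  field
    arr  : Ev → Ev → Bool
    Drop : Ev → Ev → Ev → Bool
    Add  : Ev → Ev → Ev → Bool
    wf1 : ∀ d c t → Drop d c t ≡ true → (∀ a → Add a c t ≡ false) → arr c t ≡ true
    wf2 : ∀ d c t → Drop d c t ≡ true → ¬ (d ≡ c) × ¬ (d ≡ t)
    wf3 : ∀ a c t → Add a c t ≡ true → (∀ d → Drop d c t ≡ false) → arr c t ≡ false
    wf4 : ∀ a c t → Add a c t ≡ true → ¬ (a ≡ c) × ¬ (a ≡ t)
    wf5 : ∀ a c t → Add a c t ≡ true → Drop a c t ≡ false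

Rel : Set
Rel = Ev → Ev → Bool

State : Set
State = Cfg × Rel

module _ (Δ : DCES) where
  open DCES Δ

  Dropped : Cfg → Cfg → Ev → Ev → Set
  Dropped X Y c t = ∃ λ d → d ∈ Y × d ∉ X × Drop d c t ≡ true

  Added : Cfg → Cfg → Ev → Ev → Set
  Added X Y c t = ∃ λ a → a ∈ Y × a ∉ X × Add a c t ≡ true

  DStep : State → State → Set
  DStep (X , RX) (Y , RY) =
    X ⊂ Y
    × (∀ e → e ∈ Y → e ∉ X → ∀ e' → RX e' e ≡ true → e' ∈ X)
    × (∀ c t → (RY c t ≡ true) ⇔ ((RX c t ≡ true × ¬ Dropped X Y c t) ⊎ Added X Y c t))
    × (∀ c t → Added X Y c t → Dropped X Y c t → c ∈ X ⊎ t ∈ X)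
    × (∀ t a → t ∈ Y → t ∉ X → a ∈ Y → a ∉ X → ∀ c → Add a c t ≡ true → c ∈ X)

  DReach : State → Set
  DReach s = Star DStep (⊥ , arr) s

  DConfig : Cfg → Set
  DConfig X = ∃ λ R → DReach (X , R)

TransEquiv : DCES → RCES → Set
TransEquiv Δ ρ =
  (∀ X → RReach ρ X ⇔ DConfig Δ X)
  × (∀ X Y → RReach ρ X → RReach ρ Y →
       RStep ρ X Y ⇔ (∃ λ RX → ∃ λ RY →
          DReach Δ (X , RX) × DReach Δ (Y , RY) × DStep Δ (X , RX) (Y , RY)))

∅ A B C AB AC BC ABC : Cfg
∅   = false ∷ false ∷ false ∷ []
A   = true  ∷ false ∷ false ∷ []
B   = false ∷ true  ∷ false ∷ []
C   = false ∷ false ∷ true  ∷ []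
AB  = true  ∷ true  ∷ false ∷ []
AC  = true  ∷ false ∷ true  ∷ []
BC  = false ∷ true  ∷ true  ∷ []
ABC = true  ∷ true  ∷ true  ∷ []

data GammaTrans : Cfg → Cfg → Set where
  t∅A   : GammaTrans ∅ A
  t∅B   : GammaTrans ∅ B
  t∅C   : GammaTrans ∅ C
  tAAB  : GammaTrans A AB
  tAAC  : GammaTrans A AC
  tBAB  : GammaTrans B AB
  tBBC  : GammaTrans B BC
  tCAC  : GammaTrans C AC
  tCBC  : GammaTrans C BC
  tACABC : GammaTrans AC ABC
  tBCABC : GammaTrans BC ABC

{-# OPTIONS --safe #-}
-- Whether c can fire at a reachable state (AB, R) of Δ depends only on the self-loop c → c in R,
-- since a and b have already occurred. Without the loop, firing c gives a transition AB ↦ ABC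
-- that ρ_γ lacks. With it, the loop is either initial, which blocks ∅ ↦ C, or was added by a or b;
-- then it is already present at {a} resp. {b} and blocks {a} ↦ {a,c} resp. {b} ↦ {b,c}.
module Submission where

open import Defs
open import Relation.Nullary using (¬_)
open import Function.Base using (id; _∘_)
open import Function.Bundles using (_⇔_; mk⇔; Equivalence)
open import Data.Fin using (zero; suc)
open import Data.Fin.Subset using (_∈_; _∉_; _∪_; ⁅_⁆; ⊥)
open import Data.Fin.Subset.Properties using (∉⊥; x∈⁅x⁆; x∈⁅y⁆⇒x≡y; p⊆p∪q; x∈p∪q⁻; x∈p∪q⁺)
open import Data.Vec.Base using (here; there)
open import Data.Bool using (Bool; true; false; _∨_; _∧_; not)
open import Data.Product using (_×_; _,_; ∃; proj₁; proj₂; map₂)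
open import Data.Sum as Sum using (_⊎_; inj₁; inj₂)
open import Data.Empty using (⊥-elim)
open import Relation.Binary.PropositionalEquality using (_≡_; refl; sym; trans; subst)
open import Relation.Binary.Construct.Closure.ReflexiveTransitive using (ε; _◅_; _◅◅_; fold)

open Equivalence

∨-∧-not≡true : ∀ x y z → (x ∨ (y ∧ not z)) ≡ true ⇔ ((y ≡ true × ¬ z ≡ true) ⊎ x ≡ true)
∨-∧-not≡true x y z = mk⇔ (to′ x y z) (from′ x y z)
  where
  to′ : ∀ x y z → (x ∨ (y ∧ not z)) ≡ true → (y ≡ true × ¬ z ≡ true) ⊎ x ≡ true
  to′ true  _     _     _  = inj₂ refl
  to′ false true  false _  = inj₁ (refl , λ ())
  to′ false true  true  ()
  to′ false false _     ()

  from′ : ∀ x y z → (y ≡ true × ¬ z ≡ true) ⊎ x ≡ true → (x ∨ (y ∧ not z)) ≡ true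
  from′ true  _ _     _                  = refl
  from′ false _ _     (inj₂ ())
  from′ false _ false (inj₁ (refl , _))  = refl
  from′ false _ true  (inj₁ (_ , z≢true)) = ⊥-elim (z≢true refl)

module _ (Δ : DCES) where
  open DCES Δ

  DReach-invariant : (P : State → Set) → P (⊥ , arr) →
                     (∀ {s s′} → P s → DStep Δ s s′ → P s′) →
                     ∀ {s} → DReach Δ s → P s
  DReach-invariant P P-init P-step reach =
    fold (λ s s′ → P s → P s′) (λ st k → k ∘ (λ p → P-step p st)) id reach P-init

  DReach-∅ : ∀ {R} → DReach Δ (⊥ , R) → R ≡ arr
  DReach-∅ reach = DReach-invariant Initial (λ _ → refl) step reach refl
    where
    Initial : State → Set
    Initial (X , R) = X ≡ ⊥ → R ≡ arr

    step : ∀ {s s′} → Initial s → DStep Δ s s′ → Initial s′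
    step _ ((_ , _ , e∈⊥ , _) , _) refl = ⊥-elim (∉⊥ e∈⊥)

  DReach-cause : ∀ {X R c t} → DReach Δ (X , R) → R c t ≡ true →
                 arr c t ≡ true ⊎ ∃ λ x → x ∈ X × Add x c t ≡ true
  DReach-cause {c = c} {t} = DReach-invariant Explained inj₁ step
    where
    Explained : State → Set
    Explained (X , R) = R c t ≡ true → arr c t ≡ true ⊎ ∃ λ x → x ∈ X × Add x c t ≡ true

    step : ∀ {s s′} → Explained s → DStep Δ s s′ → Explained s′
    step explained ((X⊆Y , _) , _ , update , _) Rct with to (update c t) Rct
    ... | inj₁ (RXct , _)          = Sum.map₂ (map₂ (λ (x∈X , add) → X⊆Y x∈X , add)) (explained RXct)
    ... | inj₂ (x , x∈Y , _ , add) = inj₂ (x , x∈Y , add)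

  DReach-⁅⁆ : ∀ {x R c t} → DReach Δ (⁅ x ⁆ , R) → Add x c t ≡ true → R c t ≡ true
  DReach-⁅⁆ {x} {c = c} {t} reach add = DReach-invariant Added-by-x init step reach refl
    where
    Added-by-x : State → Set
    Added-by-x (X , R) = X ≡ ⁅ x ⁆ → R c t ≡ true

    init : Added-by-x (⊥ , arr)
    init ⊥≡⁅x⁆ = ⊥-elim (∉⊥ (subst (x ∈_) (sym ⊥≡⁅x⁆) (x∈⁅x⁆ x)))

    step : ∀ {s s′} → Added-by-x s → DStep Δ s s′ → Added-by-x s′
    step _ ((_ , e , e∈⁅x⁆ , e∉X) , _ , update , _) refl with x∈⁅y⁆⇒x≡y x e∈⁅x⁆
    ... | refl = from (update c t) (inj₂ (e , e∈⁅x⁆ , e∉X , add))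

  DStep-new-¬self-cause : ∀ {X R Y R′ e} → DStep Δ (X , R) (Y , R′) → e ∈ Y → e ∉ X → ¬ R e e ≡ true
  DStep-new-¬self-cause (_ , causes , _) e∈Y e∉X Ree = e∉X (causes _ e∈Y e∉X _ Ree)

  fire : Ev → Rel → Rel
  fire e R c t = Add e c t ∨ (R c t ∧ not (Drop e c t))

  module _ {X : Cfg} {e : Ev} (e∉X : e ∉ X) where

    new-is-e : ∀ {d} → d ∈ X ∪ ⁅ e ⁆ → d ∉ X → d ≡ e
    new-is-e {d} d∈Y d∉X with x∈p∪q⁻ X ⁅ e ⁆ d∈Y
    ... | inj₁ d∈X   = ⊥-elim (d∉X d∈X)
    ... | inj₂ d∈⁅e⁆ = x∈⁅y⁆⇒x≡y e d∈⁅e⁆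

    caused-by-new⇔caused-by-e : ∀ (F : Ev → Ev → Ev → Bool) {c t} →
      (∃ λ d → d ∈ X ∪ ⁅ e ⁆ × d ∉ X × F d c t ≡ true) ⇔ F e c t ≡ true
    caused-by-new⇔caused-by-e F = mk⇔ by-e (λ Fect → e , e∈Y , e∉X , Fect)
      where
      e∈Y : e ∈ X ∪ ⁅ e ⁆
      e∈Y = x∈p∪q⁺ (inj₂ (x∈⁅x⁆ e))

      by-e : ∀ {c t} → (∃ λ d → d ∈ X ∪ ⁅ e ⁆ × d ∉ X × F d c t ≡ true) → F e c t ≡ true
      by-e (d , d∈Y , d∉X , Fdct) with new-is-e d∈Y d∉X
      ... | refl = Fdct

    DStep-fire : ∀ {R} → (∀ c → R c e ≡ true → c ∈ X) → DStep Δ (X , R) (X ∪ ⁅ e ⁆ , fire e R)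
    DStep-fire {R} causes = (p⊆p∪q ⁅ e ⁆ , e , x∈p∪q⁺ (inj₂ (x∈⁅x⁆ e)) , e∉X)
                          , enabled , update , no-clash , no-self-add
      where
      dropped⇔ : ∀ {c t} → Dropped Δ X (X ∪ ⁅ e ⁆) c t ⇔ Drop e c t ≡ true
      dropped⇔ = caused-by-new⇔caused-by-e Drop

      added⇔ : ∀ {c t} → Added Δ X (X ∪ ⁅ e ⁆) c t ⇔ Add e c t ≡ true
      added⇔ = caused-by-new⇔caused-by-e Add

      enabled : ∀ e′ → e′ ∈ X ∪ ⁅ e ⁆ → e′ ∉ X → ∀ c → R c e′ ≡ true → c ∈ X
      enabled e′ e′∈Y e′∉X with new-is-e e′∈Y e′∉X
      ... | refl = causes

      update : ∀ c t → (fire e R c t ≡ true) ⇔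
               ((R c t ≡ true × ¬ Dropped Δ X (X ∪ ⁅ e ⁆) c t) ⊎ Added Δ X (X ∪ ⁅ e ⁆) c t)
      update c t = mk⇔
        (Sum.map (map₂ (λ ¬drop → ¬drop ∘ to dropped⇔)) (from added⇔) ∘ to bool⇔)
        (from bool⇔ ∘ Sum.map (map₂ (λ ¬dropped → ¬dropped ∘ from dropped⇔)) (to added⇔))
        where
        bool⇔ : (fire e R c t ≡ true) ⇔ ((R c t ≡ true × ¬ Drop e c t ≡ true) ⊎ Add e c t ≡ true)
        bool⇔ = ∨-∧-not≡true (Add e c t) (R c t) (Drop e c t)

      no-clash : ∀ c t → Added Δ X (X ∪ ⁅ e ⁆) c t → Dropped Δ X (X ∪ ⁅ e ⁆) c t → c ∈ X ⊎ t ∈ X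
      no-clash c t added dropped with trans (sym (to dropped⇔ dropped)) (wf5 e c t (to added⇔ added))
      ... | ()

      no-self-add : ∀ t a → t ∈ X ∪ ⁅ e ⁆ → t ∉ X → a ∈ X ∪ ⁅ e ⁆ → a ∉ X →
                    ∀ c → Add a c t ≡ true → c ∈ X
      no-self-add t a t∈Y t∉X a∈Y a∉X c add with new-is-e t∈Y t∉X | new-is-e a∈Y a∉X
      ... | refl | refl = ⊥-elim (proj₂ (wf4 e c e add) refl)

c : Ev
c = suc (suc zero)

c∉AB : c ∉ AB
c∉AB (there (there ()))

¬γ-AB→ABC : ¬ GammaTrans AB ABC
¬γ-AB→ABC ()

module TransEquivγ (ρ : RCES) (reachρ : ∀ X → RReach ρ X) (γ : ∀ X Y → RStep ρ X Y ⇔ GammaTrans X Y)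
                   (Δ : DCES) (equiv : TransEquiv Δ ρ) where

  γ⇒DStep : ∀ {X Y} → GammaTrans X Y →
            ∃ λ RX → ∃ λ RY → DReach Δ (X , RX) × DReach Δ (Y , RY) × DStep Δ (X , RX) (Y , RY)
  γ⇒DStep {X} {Y} = to (proj₂ equiv X Y (reachρ X) (reachρ Y)) ∘ from (γ X Y)

  DStep⇒γ : ∀ {X RX Y RY} → DReach Δ (X , RX) → DReach Δ (Y , RY) → DStep Δ (X , RX) (Y , RY) →
            GammaTrans X Y
  DStep⇒γ {X} {RX} {Y} {RY} reachX reachY step =
    to (γ X Y) (from (proj₂ equiv X Y (reachρ X) (reachρ Y)) (RX , RY , reachX , reachY , step))

  ¬always-self-caused : ∀ {X Y e} → GammaTrans X Y → e ∈ Y → e ∉ X →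
                        ¬ (∀ {R} → DReach Δ (X , R) → R e e ≡ true)
  ¬always-self-caused γXY e∈Y e∉X self-caused with γ⇒DStep γXY
  ... | _ , _ , reachX , _ , stepXY = DStep-new-¬self-cause Δ stepXY e∈Y e∉X (self-caused reachX)

  self-caused-in-AB : ∀ {R} → DReach Δ (AB , R) → R c c ≡ true
  self-caused-in-AB {R} reachAB with R c c in Rcc
  ... | true  = refl
  ... | false = ⊥-elim (¬γ-AB→ABC (DStep⇒γ reachAB (reachAB ◅◅ fire-c ◅ ε) fire-c))
    where
    enabled : ∀ e → R e c ≡ true → e ∈ AB
    enabled zero             _    = here
    enabled (suc zero)       _    = there here
    enabled (suc (suc zero)) Rcc′ with trans (sym Rcc′) Rcc
    ... | ()

    fire-c : DStep Δ (AB , R) (ABC , fire Δ c R)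
    fire-c = DStep-fire Δ c∉AB enabled

  ¬self-caused-in-AB : ∀ {R} → DReach Δ (AB , R) → ¬ R c c ≡ true
  ¬self-caused-in-AB reachAB Rcc with DReach-cause Δ reachAB Rcc
  ... | inj₁ arr-cc =
    ¬always-self-caused t∅C (there (there here)) ∉⊥
      (λ reach∅ → subst (λ R → R c c ≡ true) (sym (DReach-∅ Δ reach∅)) arr-cc)
  ... | inj₂ (zero , _ , add) =
    ¬always-self-caused tAAC (there (there here)) (λ { (there (there ())) }) (λ reachA → DReach-⁅⁆ Δ reachA add)
  ... | inj₂ (suc zero , _ , add) =
    ¬always-self-caused tBBC (there (there here)) (λ { (there (there ())) }) (λ reachB → DReach-⁅⁆ Δ reachB add)
  ... | inj₂ (suc (suc zero) , c∈AB , _) = c∉AB c∈AB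

lemma6p4 : (ρ : RCES)
    → (∀ X → RReach ρ X)
    → (∀ X Y → RStep ρ X Y ⇔ GammaTrans X Y)
    → (Δ : DCES) → ¬ TransEquiv Δ ρ
lemma6p4 ρ reachρ γ Δ equiv with to (proj₁ equiv AB) (reachρ AB)
... | _ , reachAB = ¬self-caused-in-AB reachAB (self-caused-in-AB reachAB)
  where open TransEquivγ ρ reachρ γ Δ equiv
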